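{- Let $V$ be a finite nonempty set of players. (1) The win-type of every game-tree with players in $V$ is a strong simple game on $V$. (2) Conversely, every strong simple game on $V$ is the win-type of some game-tree with players in $V$.
   Context: A game on $V$ is an upward closed family of subsets of $V$; it is strong if for every $A\subseteq V$, $A\in S$ or $V\setminus A\in S$, and simple if no $A$ has both $A\in S$ and $V\setminus A\in S$. A game-tree is a finite rooted tree in which every internal node has exactly two children and is labeled by a player of $V$ (the player who chooses which child to move to), and every leaf is labeled by a player of $V$ (the winner). A coalition $A\subseteq V$ wins the game-tree if its members have a joint strategy guaranteeing that the winner is in $A$; the win-type is the set of winning coalitions. Equivalently, recursively: a single leaf labeled $x$ has win-type $\mathrm{Dict}_x=\{A: x\in A\}$, and a tree whose root is labeled $a$ with subtrees of win-types $S_1,S_2$ has win-type $\chi_a(S_1,S_2)=(S_1\cap S_2)\cup\{A\in S_1\cup S_2: a\in A\}$. -}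

module Defs where

open import Data.Nat using (ℕ)
open import Data.Fin using (Fin)
open import Data.Fin.Subset using (Subset; _∈_; _⊆_; ∁)
open import Data.Product using (_×_)
open import Data.Sum using (_⊎_)
open import Data.Empty using (⊥)

Family : ℕ → Set₁
Family n = Subset n → Set

IsGame : ∀ {n} → Family n → Set
IsGame {n} S = ∀ (A B : Subset n) → A ⊆ B → S A → S B

IsStrong : ∀ {n} → Family n → Set
IsStrong {n} S = ∀ (A : Subset n) → S A ⊎ S (∁ A)

IsSimple : ∀ {n} → Family n → Set
IsSimple {n} S = ∀ (A : Subset n) → S A → S (∁ A) → ⊥

IsStrongSimpleGame : ∀ {n} → Family n → Set
IsStrongSimpleGame S = IsGame S × IsStrong S × IsSimple S

-- Game-trees: binary trees, internal nodes labelled by the chooser,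
-- leaves labelled by the winner.
data GameTree (n : ℕ) : Set where
  leaf : Fin n → GameTree n
  node : Fin n → GameTree n → GameTree n → GameTree n

Dict : ∀ {n} → Fin n → Family n
Dict x A = x ∈ A

χ : ∀ {n} → Fin n → Family n → Family n → Family n
χ a S₁ S₂ A = (S₁ A × S₂ A) ⊎ ((S₁ A ⊎ S₂ A) × a ∈ A)

winType : ∀ {n} → GameTree n → Family n
winType (leaf x) = Dict x
winType (node a T₁ T₂) = χ a (winType T₁) (winType T₂)

-- (1) Dictatorships are strong simple games and χ_a preserves monotonicity,
-- strongness and simplicity.
-- (2) By induction on the number of players. If player 0 wins alone, the game
-- is the dictatorship of 0. Otherwise the coalition of all other players wins,
-- and for every other player b the game "player 0 votes as b" is a strong
-- simple game on the other players, realised by a tree T_b. The tree in which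
-- player 0 chooses among the T_b realises the game: a coalition containing 0
-- wins iff it wins when 0 votes as one of its members, and a coalition without
-- 0 wins iff it wins whichever b player 0 votes as.
module Submission where

open import Defs
open import Data.Nat using (ℕ; suc; zero)
open import Data.Fin using (Fin; zero; suc)
open import Data.Fin.Subset
  using (Subset; Side; _∈_; _∉_; _⊆_; ∁; ⁅_⁆; inside; outside)
open import Data.Fin.Subset.Properties
  using (_∈?_; nonempty?; Empty-unique; x∈∁p⇒x∉p; x∉p⇒x∈∁p; x∉∁p⇒x∈p;
         x∈⁅y⁆⇒x≡y; drop-there; out⊆; ⊆-refl; ⊥⊆)
open import Data.Vec using (_∷_; lookup; here; there)
open import Data.Vec.Properties using (lookup-map; []=⇒lookup; lookup⇒[]=)
open import Data.Bool using (not)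
open import Data.Product using (_×_; Σ; _,_; proj₁; proj₂)
open import Data.Product.Function.NonDependent.Propositional using (_×-⇔_)
open import Data.Product.Function.Dependent.Propositional using (congˡ)
open import Data.Sum using (inj₁; inj₂)
open import Data.Sum.Function.Propositional using (_⊎-⇔_)
open import Function using (_∘_)
open import Function.Bundles using (_⇔_; mk⇔; Equivalence)
open import Function.Properties.Equivalence using (⇔-setoid)
open import Level using (0ℓ)
open import Relation.Nullary using (yes; no; contradiction)
open import Relation.Nullary.Decidable using (decidable-stable)
open import Relation.Binary.PropositionalEquality using (_≡_; refl; sym; cong; subst)

open Equivalence using (to; from)

private
  variable
    n m : ℕ
    S S₁ S₂ : Family n
    A B : Subset n
    a b x : Fin n

Dict-isStrongSimpleGame : (x : Fin n) → IsStrongSimpleGame (Dict x)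
Dict-isStrongSimpleGame x = isGame , isStrong , isSimple
  where
  isGame : IsGame (Dict x)
  isGame A B A⊆B = A⊆B
  isStrong : IsStrong (Dict x)
  isStrong A with x ∈? A
  ... | yes x∈A = inj₁ x∈A
  ... | no x∉A = inj₂ (x∉p⇒x∈∁p x∉A)
  isSimple : IsSimple (Dict x)
  isSimple A x∈A x∈∁A = x∈∁p⇒x∉p x∈∁A x∈A

χ-isGame : (a : Fin n) → IsGame S₁ → IsGame S₂ → IsGame (χ a S₁ S₂)
χ-isGame a mono₁ mono₂ A B A⊆B (inj₁ (p , q)) =
  inj₁ (mono₁ A B A⊆B p , mono₂ A B A⊆B q)
χ-isGame a mono₁ mono₂ A B A⊆B (inj₂ (inj₁ p , a∈A)) =
  inj₂ (inj₁ (mono₁ A B A⊆B p) , A⊆B a∈A)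
χ-isGame a mono₁ mono₂ A B A⊆B (inj₂ (inj₂ q , a∈A)) =
  inj₂ (inj₂ (mono₂ A B A⊆B q) , A⊆B a∈A)

-- When the subgames disagree on A, the chooser a decides between A and ∁ A.
χ-isStrong : (a : Fin n) → IsStrong S₁ → IsStrong S₂ → IsStrong (χ a S₁ S₂)
χ-isStrong a strong₁ strong₂ A with strong₁ A | strong₂ A | a ∈? A
... | inj₁ p | inj₁ q | _       = inj₁ (inj₁ (p , q))
... | inj₂ p | inj₂ q | _       = inj₂ (inj₁ (p , q))
... | inj₁ p | inj₂ q | yes a∈A = inj₁ (inj₂ (inj₁ p , a∈A))
... | inj₁ p | inj₂ q | no a∉A  = inj₂ (inj₂ (inj₂ q , x∉p⇒x∈∁p a∉A))
... | inj₂ p | inj₁ q | yes a∈A = inj₁ (inj₂ (inj₂ q , a∈A))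
... | inj₂ p | inj₁ q | no a∉A  = inj₂ (inj₂ (inj₁ p , x∉p⇒x∈∁p a∉A))

χ-isSimple : (a : Fin n) → IsSimple S₁ → IsSimple S₂ → IsSimple (χ a S₁ S₂)
χ-isSimple a simple₁ simple₂ A (inj₁ (p , _)) (inj₁ (p′ , _))       = simple₁ A p p′
χ-isSimple a simple₁ simple₂ A (inj₁ (p , _)) (inj₂ (inj₁ p′ , _))  = simple₁ A p p′
χ-isSimple a simple₁ simple₂ A (inj₁ (_ , q)) (inj₂ (inj₂ q′ , _))  = simple₂ A q q′
χ-isSimple a simple₁ simple₂ A (inj₂ (inj₁ p , _)) (inj₁ (p′ , _))  = simple₁ A p p′
χ-isSimple a simple₁ simple₂ A (inj₂ (inj₂ q , _)) (inj₁ (_ , q′))  = simple₂ A q q′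
χ-isSimple a simple₁ simple₂ A (inj₂ (_ , a∈A)) (inj₂ (_ , a∈∁A)) = x∈∁p⇒x∉p a∈∁A a∈A

χ-isStrongSimpleGame : (a : Fin n) → IsStrongSimpleGame S₁ → IsStrongSimpleGame S₂ →
  IsStrongSimpleGame (χ a S₁ S₂)
χ-isStrongSimpleGame a (mono₁ , strong₁ , simple₁) (mono₂ , strong₂ , simple₂) =
  χ-isGame a mono₁ mono₂ , χ-isStrong a strong₁ strong₂ , χ-isSimple a simple₁ simple₂

winType-isStrongSimpleGame : (T : GameTree n) → IsStrongSimpleGame (winType T)
winType-isStrongSimpleGame (leaf x)       = Dict-isStrongSimpleGame x
winType-isStrongSimpleGame (node a T₁ T₂) =
  χ-isStrongSimpleGame a (winType-isStrongSimpleGame T₁) (winType-isStrongSimpleGame T₂)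

⁅x⁆⊆p : x ∈ A → ⁅ x ⁆ ⊆ A
⁅x⁆⊆p {x = x} {A = A} x∈A y∈⁅x⁆ = subst (_∈ A) (sym (x∈⁅y⁆⇒x≡y x y∈⁅x⁆)) x∈A

p⊆∁⁅x⁆ : x ∉ A → A ⊆ ∁ ⁅ x ⁆
p⊆∁⁅x⁆ {x = x} {A = A} x∉A y∈A =
  x∉p⇒x∈∁p (λ y∈⁅x⁆ → x∉A (subst (_∈ A) (x∈⁅y⁆⇒x≡y x y∈⁅x⁆) y∈A))

dictator : IsGame S → IsSimple S → S ⁅ x ⁆ → (A : Subset n) → S A ⇔ x ∈ A
dictator {x = x} mono simple s⁅x⁆ A = mk⇔
  (λ sA → decidable-stable (x ∈? A) λ x∉A →
     simple ⁅ x ⁆ s⁅x⁆ (mono A (∁ ⁅ x ⁆) (p⊆∁⁅x⁆ x∉A) sA))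
  (λ x∈A → mono ⁅ x ⁆ A (⁅x⁆⊆p x∈A) s⁅x⁆)

-- Player 0 joins the coalition A of players 1, …, n exactly when player suc b
-- is in it.
follow : Fin n → Subset n → Subset (suc n)
follow b A = lookup A b ∷ A

lookup-∉ : b ∉ A → lookup A b ≡ outside
lookup-∉ {b = b} {A = A} b∉A with lookup A b in eq
... | outside = refl
... | inside  = contradiction (lookup⇒[]= b A eq) b∉A

follow-∈ : b ∈ A → follow b A ≡ inside ∷ A
follow-∈ {A = A} b∈A = cong (_∷ A) ([]=⇒lookup b∈A)

follow-∉ : b ∉ A → follow b A ≡ outside ∷ A
follow-∉ {A = A} b∉A = cong (_∷ A) (lookup-∉ b∉A)

∁-follow : (b : Fin n) (A : Subset n) → ∁ (follow b A) ≡ follow b (∁ A)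
∁-follow b A = cong (_∷ ∁ A) (sym (lookup-map b not A))

follow-mono : A ⊆ B → follow b A ⊆ follow b B
follow-mono {A = A} {B = B} {b = b} A⊆B {zero} b∈A =
  lookup⇒[]= zero (follow b B) ([]=⇒lookup (A⊆B (lookup⇒[]= b A ([]=⇒lookup b∈A))))
follow-mono A⊆B {suc y} (there y∈A) = there (A⊆B y∈A)

follow-isStrongSimpleGame : IsStrongSimpleGame S → (b : Fin n) →
  IsStrongSimpleGame (S ∘ follow b)
follow-isStrongSimpleGame {S = S} (mono , strong , simple) b = isGame , isStrong , isSimple
  where
  isGame : IsGame (S ∘ follow b)
  isGame A B A⊆B = mono (follow b A) (follow b B) (follow-mono A⊆B)
  isStrong : IsStrong (S ∘ follow b)
  isStrong A with strong (follow b A)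
  ... | inj₁ p = inj₁ p
  ... | inj₂ q = inj₂ (subst S (∁-follow b A) q)
  isSimple : IsSimple (S ∘ follow b)
  isSimple A p q = simple (follow b A) p (subst S (sym (∁-follow b A)) q)

inside∷⇔∃follow : {S : Family (suc n)} → IsGame S → IsSimple S → S (∁ ⁅ zero ⁆) →
  (A : Subset n) → S (inside ∷ A) ⇔ Σ (Fin n) (λ b → S (follow b A))
inside∷⇔∃follow {n = n} {S = S} mono simple others A = mk⇔ pick
  (λ (b , p) → mono (follow b A) (inside ∷ A) (∷⊆inside∷ (lookup A b)) p)
  where
  ∷⊆inside∷ : ∀ s → s ∷ A ⊆ inside ∷ A
  ∷⊆inside∷ inside  = ⊆-refl
  ∷⊆inside∷ outside = out⊆ ⊆-refl
  pick : S (inside ∷ A) → Σ (Fin n) (λ b → S (follow b A))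
  pick p with nonempty? A
  ... | yes (b , b∈A) = b , subst S (sym (follow-∈ b∈A)) p
  ... | no empty =
    contradiction others (simple ⁅ zero ⁆ (subst (λ X → S (inside ∷ X)) (Empty-unique empty) p))

outside∷⇔∀follow : {S : Family (suc n)} → IsGame S → S (∁ ⁅ zero ⁆) →
  (A : Subset n) → S (outside ∷ A) ⇔ ((b : Fin n) → S (follow b A))
outside∷⇔∀follow {n = n} {S = S} mono others A = mk⇔
  (λ p b → mono (outside ∷ A) (follow b A) (out⊆ ⊆-refl) p)
  gather
  where
  gather : ((b : Fin n) → S (follow b A)) → S (outside ∷ A)
  gather h with nonempty? (∁ A)
  ... | yes (b , b∈∁A) = subst S (follow-∉ (x∈∁p⇒x∉p b∈∁A)) (h b)
  ... | no empty = mono (∁ ⁅ zero ⁆) (outside ∷ A)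
    (out⊆ λ {y} _ → x∉∁p⇒x∈p (λ y∈∁A → empty (y , y∈∁A))) others

liftPlayers : GameTree n → GameTree (suc n)
liftPlayers (leaf x)       = leaf (suc x)
liftPlayers (node a T₁ T₂) = node (suc a) (liftPlayers T₁) (liftPlayers T₂)

winType-liftPlayers : (T : GameTree n) (s : Side) (A : Subset n) →
  winType (liftPlayers T) (s ∷ A) ⇔ winType T A
winType-liftPlayers (leaf x)       s A = mk⇔ drop-there there
winType-liftPlayers (node a T₁ T₂) s A =
  (ih₁ ×-⇔ ih₂) ⊎-⇔ ((ih₁ ⊎-⇔ ih₂) ×-⇔ mk⇔ drop-there there)
  where
  ih₁ : winType (liftPlayers T₁) (s ∷ A) ⇔ winType T₁ A
  ih₁ = winType-liftPlayers T₁ s A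
  ih₂ : winType (liftPlayers T₂) (s ∷ A) ⇔ winType T₂ A
  ih₂ = winType-liftPlayers T₂ s A

choice : Fin m → (k : ℕ) → (Fin (suc k) → GameTree m) → GameTree m
choice a zero    Ts = Ts zero
choice a (suc k) Ts = node a (Ts zero) (choice a k (Ts ∘ suc))

winType-choice-∈ : a ∈ A → (k : ℕ) (Ts : Fin (suc k) → GameTree m) →
  winType (choice a k Ts) A ⇔ Σ (Fin (suc k)) (λ i → winType (Ts i) A)
winType-choice-∈ a∈A zero    Ts = mk⇔ (zero ,_) λ { (zero , w) → w }
winType-choice-∈ {a = a} {A = A} a∈A (suc k) Ts = mk⇔ pick choose
  where
  ih : winType (choice a k (Ts ∘ suc)) A ⇔ Σ (Fin (suc k)) (λ i → winType (Ts (suc i)) A)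
  ih = winType-choice-∈ a∈A k (Ts ∘ suc)
  pick : winType (choice a (suc k) Ts) A → Σ (Fin (suc (suc k))) (λ i → winType (Ts i) A)
  pick (inj₁ (w , _))       = zero , w
  pick (inj₂ (inj₁ w , _))  = zero , w
  pick (inj₂ (inj₂ w , _)) with to ih w
  ... | i , w′ = suc i , w′
  choose : Σ (Fin (suc (suc k))) (λ i → winType (Ts i) A) → winType (choice a (suc k) Ts) A
  choose (zero , w)  = inj₂ (inj₁ w , a∈A)
  choose (suc i , w) = inj₂ (inj₂ (from ih (i , w)) , a∈A)

winType-choice-∉ : a ∉ A → (k : ℕ) (Ts : Fin (suc k) → GameTree m) →
  winType (choice a k Ts) A ⇔ ((i : Fin (suc k)) → winType (Ts i) A)
winType-choice-∉ a∉A zero    Ts = mk⇔ (λ { w zero → w }) (λ h → h zero)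
winType-choice-∉ {a = a} {A = A} a∉A (suc k) Ts =
  mk⇔ split (λ h → inj₁ (h zero , from ih (h ∘ suc)))
  where
  ih : winType (choice a k (Ts ∘ suc)) A ⇔ ((i : Fin (suc k)) → winType (Ts (suc i)) A)
  ih = winType-choice-∉ a∉A k (Ts ∘ suc)
  split : winType (choice a (suc k) Ts) A → (i : Fin (suc (suc k))) → winType (Ts i) A
  split (inj₁ (w , _)) zero    = w
  split (inj₁ (_ , w)) (suc i) = to ih w i
  split (inj₂ (_ , a∈A))       = contradiction a∈A a∉A

Π-⇔ : {I : Set} {P Q : I → Set} → (∀ i → P i ⇔ Q i) → ((i : I) → P i) ⇔ ((i : I) → Q i)
Π-⇔ P⇔Q = mk⇔ (λ h i → to (P⇔Q i) (h i)) (λ h i → from (P⇔Q i) (h i))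

realise : (n : ℕ) (S : Family (suc n)) → IsStrongSimpleGame S →
  Σ (GameTree (suc n)) (λ T → (A : Subset (suc n)) → S A ⇔ winType T A)
realise n S (mono , strong , simple) with strong ⁅ zero ⁆
... | inj₁ alone = leaf zero , dictator mono simple alone
-- With a single player, ∁ ⁅ zero ⁆ is the empty coalition.
realise zero S (mono , _ , simple) | inj₂ others =
  leaf zero , dictator mono simple (mono _ _ ⊥⊆ others)
realise (suc n) S G@(mono , _ , simple) | inj₂ others = choice zero n subtree , realises
  where
  open import Relation.Binary.Reasoning.Setoid (⇔-setoid 0ℓ)
  follower : (b : Fin (suc n)) →
    Σ (GameTree (suc n)) (λ T → (A : Subset (suc n)) → S (follow b A) ⇔ winType T A)
  follower b = realise n (S ∘ follow b) (follow-isStrongSimpleGame G b)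
  subtree : Fin (suc n) → GameTree (suc (suc n))
  subtree b = liftPlayers (proj₁ (follower b))
  follow⇔subtree : ∀ b s A → S (follow b A) ⇔ winType (subtree b) (s ∷ A)
  follow⇔subtree b s A = begin
    S (follow b A)                           ≈⟨ proj₂ (follower b) A ⟩
    winType (proj₁ (follower b)) A           ≈⟨ winType-liftPlayers (proj₁ (follower b)) s A ⟨
    winType (subtree b) (s ∷ A)              ∎
  realises : (A : Subset (suc (suc n))) → S A ⇔ winType (choice zero n subtree) A
  realises (inside ∷ A) = begin
    S (inside ∷ A)                                            ≈⟨ inside∷⇔∃follow mono simple others A ⟩
    Σ (Fin (suc n)) (λ b → S (follow b A))                    ≈⟨ congˡ (follow⇔subtree _ inside A) ⟩
    Σ (Fin (suc n)) (λ b → winType (subtree b) (inside ∷ A))  ≈⟨ winType-choice-∈ here n subtree ⟨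
    winType (choice zero n subtree) (inside ∷ A)              ∎
  realises (outside ∷ A) = begin
    S (outside ∷ A)                                           ≈⟨ outside∷⇔∀follow mono others A ⟩
    ((b : Fin (suc n)) → S (follow b A))                      ≈⟨ Π-⇔ (λ b → follow⇔subtree b outside A) ⟩
    ((b : Fin (suc n)) → winType (subtree b) (outside ∷ A))   ≈⟨ winType-choice-∉ (λ ()) n subtree ⟨
    winType (choice zero n subtree) (outside ∷ A)             ∎

proposition2 : (n : ℕ) →
    (((T : GameTree (suc n)) → IsStrongSimpleGame (winType T))
    × ((S : Family (suc n)) → IsStrongSimpleGame S →
         Σ (GameTree (suc n)) (λ T → (A : Subset (suc n)) → S A ⇔ winType T A)))
proposition2 n = winType-isStrongSimpleGame , realise n
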